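{- Let $d\ge3$, $\mathcal A$, $\varphi$, $\mathbf u$, $\mathcal T$, $f$ and $T_0,\dots,T_{d-1}$ be as in the context. Then for each bispecial factor $w$ of $\mathbf u$ there exist $k\in\mathcal A$ and $n\in\mathbb N$ such that $w$ or $\overline w$ is the bispecial factor associated with $f^n(T_k)$.
   Context: $\mathcal A=\{0,\dots,d-1\}$; $\varphi(i)=0(i+1)$ for $0\le i\le d-2$, $\varphi(d-1)=0(d-1)(d-1)$; $\mathbf u$ is the fixed point of $\varphi$ starting with $0$ and $\mathcal L(\mathbf u)$ its set of finite factors; $\overline w$ is the reversal of $w$. A factor $w$ is bispecial if it has at least two left extensions ($a$ with $aw\in\mathcal L(\mathbf u)$) and at least two right extensions. Let $\mathcal T=\{(a,w,b): w\text{ bispecial factor of }\mathbf u,\ a,b\in\mathcal A,\ a,b<d-1,\ aw,wb\in\mathcal L(\mathbf u)\}$; $w$ is the bispecial factor associated with $(a,w,b)$. For $(a,w,b)\in\mathcal T$ define $f(a,w,b)=(a',w',b')$ with $a'=(a+1)\bmod (d-1)$, $b'=(b+1)\bmod(d-1)$ (residues in $\{0,\dots,d-2\}$) and $w'=\varphi(w)0$ if $a<d-2,b<d-2$; $w'=\varphi(w)0(d-1)$ if $a<d-2,b=d-2$; $w'=(d-1)\varphi(w)0$ if $a=d-2,b<d-2$; $w'=(d-1)\varphi(w)0(d-1)$ if $a=b=d-2$. For $k=0,1,\dots,d-2$ let $T_k=(0,\varepsilon,k)$, and let $T_{d-1}=(0,d-1,0)$; $f^0$ is the identity. -}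

module Defs where

open import Data.Nat using (ℕ; zero; suc; _+_; _∸_; _<_; _≤_; _<ᵇ_; _≡ᵇ_; _%_)
open import Data.Bool using (Bool; true; false; if_then_else_)
open import Data.List using (List; []; _∷_; _++_; concatMap; length; lookup)
open import Data.Product using (_×_; _,_; ∃; Σ)
open import Data.Fin using (Fin; fromℕ<)
open import Relation.Binary.PropositionalEquality using (_≡_; _≢_)

-- Alphabet A = {0,…,d-1}, letters represented as natural numbers.
Word : Set
Word = List ℕ

-- The substitution φ on letters: φ(i) = 0(i+1) for i ≤ d-2, φ(d-1) = 0(d-1)(d-1).
-- (Letters ≥ d never occur; they are mapped like d-1, which is irrelevant.)
φ-letter : ℕ → ℕ → Word
φ-letter d i = if suc i <ᵇ d then 0 ∷ suc i ∷ [] else 0 ∷ (d ∸ 1) ∷ (d ∸ 1) ∷ []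

φ : ℕ → Word → Word
φ d w = concatMap (φ-letter d) w

φ^ : ℕ → ℕ → Word → Word
φ^ d zero w = w
φ^ d (suc n) w = φ d (φ^ d n w)

at : Word → ℕ → ℕ
at [] _ = 0
at (x ∷ xs) zero = x
at (x ∷ xs) (suc i) = at xs i

-- The fixed point u = lim φ^n(0) of φ starting with 0, as an infinite word ℕ → ℕ.
-- Since every image φ(i) has length ≥ 2, |φ^(i+1)(0)| ≥ i+1, and φ^n(0) is a
-- prefix of φ^(n+1)(0); so the i-th letter of u is the i-th letter of φ^(i+1)(0).
u : ℕ → ℕ → ℕ
u d i = at (φ^ d (suc i) (0 ∷ [])) i

OccursAt : ℕ → Word → ℕ → Set
OccursAt d w i = ∀ (j : Fin (length w)) → u d (i + Data.Fin.toℕ j) ≡ lookup w j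

Factor : ℕ → Word → Set
Factor d w = ∃ λ i → OccursAt d w i

Bispecial : ℕ → Word → Set
Bispecial d w =
  (Σ ℕ λ a → Σ ℕ λ a' → a ≢ a' × Factor d (a ∷ w) × Factor d (a' ∷ w)) ×
  (Σ ℕ λ b → Σ ℕ λ b' → b ≢ b' × Factor d (w ++ b ∷ []) × Factor d (w ++ b' ∷ []))

Triple : Set
Triple = ℕ × Word × ℕ

In𝒯 : ℕ → Triple → Set
In𝒯 d (a , w , b) = Bispecial d w × a < d ∸ 1 × b < d ∸ 1
                    × Factor d (a ∷ w) × Factor d (w ++ b ∷ [])

assoc : Triple → Word
assoc (a , w , b) = w

-- the map f (defined for d ≥ 2, where d-1 ≠ 0; identity otherwise)
f : ℕ → Triple → Triple
f zero t = t
f (suc zero) t = t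
f d@(suc (suc e)) (a , w , b) = (suc a % suc e , w' , suc b % suc e)
  where
    core : Word
    core = φ d w ++ 0 ∷ []
    w' : Word
    w' = (if a ≡ᵇ e then (suc e ∷ []) else []) ++ core ++
         (if b ≡ᵇ e then (suc e ∷ []) else [])

f^ : ℕ → ℕ → Triple → Triple
f^ d zero t = t
f^ d (suc n) t = f d (f^ d n t)

T : ℕ → ℕ → Triple
T d k = if k ≡ᵇ d ∸ 1 then (0 , (d ∸ 1) ∷ [] , 0) else (0 , [] , k)

module Submission where

-- Apart from ε and d-1, a bispecial factor w of u has the form P φ(v)0 S with P, S ∈ {ε, d-1},
-- where v is a shorter bispecial factor and the extensions of w are read off those of v, since
-- every 0 of u starts the image of a letter. So induction on |w| applies, with the invariant that
-- either w = ψʲ(ε) for ψ(v) = φ(v)0, whose extensions are known explicitly, or w comes with letters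
-- a, b < d-1 bounding its left and right extensions to {a, d-1} and {b, d-1}. Going from v to w
-- adds d-1 exactly on the sides where that letter is d-2 and shifts a and b by one modulo d-1,
-- which is the map f; so (a, w, b), or its reversal, lies on the f-orbit of some T_k.

open import Defs
open import Data.Nat using (ℕ; zero; suc; _+_; _∸_; _≤_; _<_; _<ᵇ_; _≡ᵇ_; _%_; z≤n; s≤s; _≟_)
open import Data.Nat.Properties
open import Data.Nat.DivMod using (m<n⇒m%n≡m; n%n≡0; m%n<n)
open import Data.Nat.Induction using (<-wellFounded)
open import Induction.WellFounded using (Acc; acc)
open import Data.Bool using (Bool; true; false; if_then_else_) renaming (T to True)
open import Data.List using ([]; _∷_; _++_; length; reverse; initLast; _∷ʳ′_)
open import Data.List.Properties
  using (++-assoc; ++-identityʳ; length-++; length-++-≤ˡ; length-++-≤ʳ; concatMap-++;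
         ∷-injectiveˡ; ∷-injectiveʳ; ∷ʳ-injectiveˡ; reverse-++; unfold-reverse)
open import Data.List.Relation.Unary.All using (All; []; _∷_)
open import Data.List.Relation.Unary.All.Properties using (++⁺)
open import Data.Product using (Σ; ∃; _×_; _,_; proj₁; proj₂)
open import Data.Sum using (_⊎_; inj₁; inj₂)
open import Data.Empty using (⊥-elim)
open import Data.Unit using (⊤; tt)
open import Relation.Nullary using (¬_; yes; no)
open import Relation.Binary.PropositionalEquality
import Data.Fin as Fin

at-++ˡ : ∀ xs ys {i} → i < length xs → at (xs ++ ys) i ≡ at xs i
at-++ˡ (x ∷ xs) ys {zero}  _         = refl
at-++ˡ (x ∷ xs) ys {suc i} (s≤s lt) = at-++ˡ xs ys lt

at-++ʳ : ∀ xs ys i → at (xs ++ ys) (length xs + i) ≡ at ys i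
at-++ʳ []       ys i = refl
at-++ʳ (x ∷ xs) ys i = at-++ʳ xs ys i

All-at : ∀ {P : ℕ → Set} xs i → All P xs → P 0 → P (at xs i)
All-at []       i       []         p0 = p0
All-at (x ∷ xs) zero    (px ∷ _)   p0 = px
All-at (x ∷ xs) (suc i) (_ ∷ pxs) p0 = All-at xs i pxs p0

module _ (m : ℕ) where

  -- d = m + 3; D = d - 1 is the only letter with an image of length 3, and e = d - 2.
  e D d : ℕ
  e = suc m
  D = suc e
  d = suc D

  -- σ c is the last letter of φ(c).
  σ : ℕ → ℕ
  σ c = if c <ᵇ D then suc c else D

  data LetterImage (c : ℕ) : Set where
    short : c < D → φ-letter d c ≡ 0 ∷ suc c ∷ [] → σ c ≡ suc c → LetterImage c
    long  : D ≤ c → φ-letter d c ≡ 0 ∷ D ∷ D ∷ [] → σ c ≡ D → LetterImage c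

  letterImage : ∀ c → LetterImage c
  letterImage c = view (c <ᵇ D) refl
    where
      image : Bool → Word
      image b = if b then 0 ∷ suc c ∷ [] else 0 ∷ D ∷ D ∷ []
      last : Bool → ℕ
      last b = if b then suc c else D
      view : ∀ b → (c <ᵇ D) ≡ b → LetterImage c
      view true  eq = short (<ᵇ⇒< c D (subst True (sym eq) _)) (cong image eq) (cong last eq)
      view false eq = long (≮⇒≥ (λ lt → subst True eq (<⇒<ᵇ lt))) (cong image eq) (cong last eq)

  σ-< : ∀ {c} → c < D → σ c ≡ suc c
  σ-< {c} lt with letterImage c
  ... | short _ _ σc = σc
  ... | long ge _ _  = ⊥-elim (<⇒≱ lt ge)

  σ-D : σ D ≡ D
  σ-D with letterImage D
  ... | short lt _ _ = ⊥-elim (<-irrefl refl lt)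
  ... | long _ _ σD  = σD

  len : ℕ → ℕ
  len c = length (φ-letter d c)

  2≤len : ∀ c → 2 ≤ len c
  2≤len c with letterImage c
  ... | short _ eq _ rewrite eq = s≤s (s≤s z≤n)
  ... | long _ eq _  rewrite eq = s≤s (s≤s z≤n)

  φ-letter-< : ∀ c → All (_< d) (φ-letter d c)
  φ-letter-< c with letterImage c
  ... | short lt eq _ rewrite eq = s≤s z≤n ∷ s≤s lt ∷ []
  ... | long _ eq _  rewrite eq = s≤s z≤n ∷ ≤-refl ∷ ≤-refl ∷ []

  φ-< : ∀ xs → All (_< d) (φ d xs)
  φ-< []       = []
  φ-< (c ∷ xs) = ++⁺ (φ-letter-< c) (φ-< xs)

  φ-++ : ∀ xs ys → φ d (xs ++ ys) ≡ φ d xs ++ φ d ys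
  φ-++ = concatMap-++ (φ-letter d)

  length-φ-≥ : ∀ xs → length xs + length xs ≤ length (φ d xs)
  length-φ-≥ []       = z≤n
  length-φ-≥ (c ∷ xs) rewrite length-++ (φ-letter d c) {φ d xs} | +-suc (length xs) (length xs) =
    +-mono-≤ (2≤len c) (length-φ-≥ xs)

  X : ℕ → Word
  X n = φ^ d n (0 ∷ [])

  opaque
    U : ℕ → ℕ
    U = u d

    U-def : ∀ i → U i ≡ u d i
    U-def i = refl

  X-extends : ∀ n → ∃ λ t → X (suc n) ≡ X n ++ t
  X-extends zero    = 1 ∷ [] , refl
  X-extends (suc n) with X-extends n
  ... | t , eq = φ d t , trans (cong (φ d) eq) (φ-++ (X n) t)

  X-prefix : ∀ {n} n' → n ≤ n' → ∃ λ t → X n' ≡ X n ++ t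
  X-prefix {n} n' le with m≤n⇒m<n∨m≡n le
  X-prefix {n} n'       le | inj₂ refl = [] , sym (++-identityʳ (X n))
  X-prefix {n} (suc n') le | inj₁ (s≤s le') with X-prefix n' le' | X-extends n'
  ... | t , eq | t' , eq' = t ++ t' , (begin
    X (suc n')      ≡⟨ eq' ⟩
    X n' ++ t'      ≡⟨ cong (_++ t') eq ⟩
    (X n ++ t) ++ t' ≡⟨ ++-assoc (X n) t t' ⟩
    X n ++ t ++ t'  ∎)
    where open ≡-Reasoning

  n<length-X : ∀ n → n < length (X n)
  n<length-X zero    = s≤s z≤n
  n<length-X (suc n) = ≤-trans (+-mono-≤ (≤-trans (s≤s z≤n) (n<length-X n)) (n<length-X n)) (length-φ-≥ (X n))

  U-X : ∀ n i → i < length (X n) → U i ≡ at (X n) i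
  U-X n i lt with ≤-total n (suc i)
  ... | inj₁ le with X-prefix (suc i) le
  ...   | t , eq = trans (U-def i) (trans (cong (λ xs → at xs i) eq) (at-++ˡ (X n) t lt))
  U-X n i lt | inj₂ le with X-prefix n le
  ...   | t , eq = trans (U-def i) (sym (trans (cong (λ xs → at xs i) eq)
                                             (at-++ˡ (X (suc i)) t (<-trans (n<1+n i) (n<length-X (suc i))))))

  U<d : ∀ i → U i < d
  U<d i = subst (_< d) (sym (U-def i)) (All-at (φ d (X i)) i (φ-< (X i)) (s≤s z≤n))

  slice : ℕ → ℕ → Word
  slice p zero    = []
  slice p (suc n) = U p ∷ slice (suc p) n

  length-slice : ∀ p n → length (slice p n) ≡ n
  length-slice p zero    = refl
  length-slice p (suc n) = cong suc (length-slice (suc p) n)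

  slice-< : ∀ p n → All (_< d) (slice p n)
  slice-< p zero    = []
  slice-< p (suc n) = U<d p ∷ slice-< (suc p) n

  slice-prefix : ∀ {p q N} N' → N' ≤ N → slice p N ≡ slice q N → slice p N' ≡ slice q N'
  slice-prefix zero _ _ = refl
  slice-prefix {N = suc N} (suc N') (s≤s le) eq =
    cong₂ _∷_ (∷-injectiveˡ eq) (slice-prefix N' le (∷-injectiveʳ eq))

  Occurs : Word → ℕ → Set
  Occurs w p = w ≡ slice p (length w)

  occurs-slice : ∀ p n → Occurs (slice p n) p
  occurs-slice p n = cong (slice p) (sym (length-slice p n))

  occurs-∷ : ∀ {c w p} → U p ≡ c → Occurs w (suc p) → Occurs (c ∷ w) p
  occurs-∷ h o = cong₂ _∷_ (sym h) o

  occurs-head : ∀ {c w p} → Occurs (c ∷ w) p → U p ≡ c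
  occurs-head o = sym (∷-injectiveˡ o)

  occurs-tail : ∀ {c w p} → Occurs (c ∷ w) p → Occurs w (suc p)
  occurs-tail o = ∷-injectiveʳ o

  occurs-++⁻ : ∀ A {B p} → Occurs (A ++ B) p → Occurs A p × Occurs B (p + length A)
  occurs-++⁻ []      {B} {p} o = refl , subst (Occurs B) (sym (+-identityʳ p)) o
  occurs-++⁻ (a ∷ A) {B} {p} o with occurs-++⁻ A (occurs-tail o)
  ... | oA , oB = occurs-∷ (occurs-head o) oA , subst (Occurs B) (sym (+-suc p (length A))) oB

  occurs-++⁺ : ∀ A {B p} → Occurs A p → Occurs B (p + length A) → Occurs (A ++ B) p
  occurs-++⁺ []      {B} {p} _  oB = subst (Occurs B) (+-identityʳ p) oB
  occurs-++⁺ (a ∷ A) {B} {p} oA oB =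
    occurs-∷ (occurs-head oA) (occurs-++⁺ A (occurs-tail oA) (subst (Occurs B) (+-suc p (length A)) oB))

  occurs-at : ∀ A {p} → (∀ r → r < length A → U (p + r) ≡ at A r) → Occurs A p
  occurs-at []      h = refl
  occurs-at (a ∷ A) {p} h =
    occurs-∷ (trans (cong U (sym (+-identityʳ p))) (h 0 (s≤s z≤n)))
             (occurs-at A (λ r lt → trans (cong U (sym (+-suc p r))) (h (suc r) (s≤s lt))))

  occurs-unique : ∀ {A B p} → Occurs A p → Occurs B p → length A ≡ length B → A ≡ B
  occurs-unique {p = p} oA oB eq = trans oA (trans (cong (slice p) eq) (sym oB))

  occurs-< : ∀ {w p} → Occurs w p → All (_< d) w
  occurs-< {w} {p} o = subst (All (_< d)) (sym o) (slice-< p (length w))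

  OccursAt⇒Occurs : ∀ w i → OccursAt d w i → Occurs w i
  OccursAt⇒Occurs []      i h = refl
  OccursAt⇒Occurs (c ∷ w) i h =
    occurs-∷ (trans (cong U (sym (+-identityʳ i))) (trans (U-def _) (h Fin.zero)))
             (OccursAt⇒Occurs w (suc i) (λ j → trans (cong (u d) (sym (+-suc i (Fin.toℕ j)))) (h (Fin.suc j))))

  -- Blocks: u as the concatenation of the images of its letters

  -- start j is the position where the image of u_j begins in u = φ(u).
  start : ℕ → ℕ
  start zero    = 0
  start (suc j) = start j + len (U j)

  offset : Word → ℕ → ℕ
  offset xs zero    = 0
  offset xs (suc j) = offset xs j + len (at xs j)

  offset-∷ : ∀ c xs j → offset (c ∷ xs) (suc j) ≡ len c + offset xs j
  offset-∷ c xs zero    = +-comm 0 (len c)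
  offset-∷ c xs (suc j) rewrite offset-∷ c xs j = +-assoc (len c) (offset xs j) _

  at-φ : ∀ xs {j r} → j < length xs → r < len (at xs j) →
         at (φ d xs) (offset xs j + r) ≡ at (φ-letter d (at xs j)) r
  at-φ (c ∷ xs) {zero}          _        lr = at-++ˡ (φ-letter d c) (φ d xs) lr
  at-φ (c ∷ xs) {suc j} {r} (s≤s lt) lr rewrite offset-∷ c xs j | +-assoc (len c) (offset xs j) r =
    trans (at-++ʳ (φ-letter d c) (φ d xs) (offset xs j + r)) (at-φ xs lt lr)

  start-offset : ∀ n j → j ≤ length (X n) → start j ≡ offset (X n) j
  start-offset n zero    _  = refl
  start-offset n (suc j) le rewrite start-offset n j (≤-trans (n≤1+n j) le) | U-X n j le = refl

  start-<-suc : ∀ j → start j < start (suc j)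
  start-<-suc j = m<m+n (start j) (≤-trans (s≤s z≤n) (2≤len (U j)))

  start-mono-< : ∀ {i j} → i < j → start i < start j
  start-mono-< {i} {suc j} (s≤s i≤j) with m≤n⇒m<n∨m≡n i≤j
  ... | inj₁ i<j  = <-trans (start-mono-< i<j) (start-<-suc j)
  ... | inj₂ refl = start-<-suc i

  start-cancel-≤ : ∀ {i j} → start i ≤ start j → i ≤ j
  start-cancel-≤ le = ≮⇒≥ (λ j<i → <⇒≱ (start-mono-< j<i) le)

  ≤-start : ∀ j → j ≤ start j
  ≤-start zero    = z≤n
  ≤-start (suc j) = ≤-trans (s≤s (≤-start j)) (start-<-suc j)

  2+≤-start : ∀ j → 2 + j ≤ start (suc j)
  2+≤-start j = subst (_≤ start (suc j)) (+-comm j 2) (+-mono-≤ (≤-start j) (2≤len (U j)))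

  U-block : ∀ j {r} → r < len (U j) → U (start j + r) ≡ at (φ-letter d (U j)) r
  U-block j {r} lr = begin
      U (start j + r)                        ≡⟨ U-X (suc n) n (<-trans (n<1+n n) (n<length-X (suc n))) ⟩
      at (φ d (X n)) (start j + r)           ≡⟨ cong (λ k → at (φ d (X n)) (k + r)) (start-offset n j (<⇒≤ j<)) ⟩
      at (φ d (X n)) (offset (X n) j + r)    ≡⟨ at-φ (X n) j< (subst (λ c → r < len c) (U-X n j j<) lr) ⟩
      at (φ-letter d (at (X n) j)) r         ≡⟨ cong (λ c → at (φ-letter d c) r) (sym (U-X n j j<)) ⟩
      at (φ-letter d (U j)) r                ∎
    where
      open ≡-Reasoning
      n = start j + r
      j< : j < length (X n)
      j< = ≤-trans (s≤s (≤-trans (≤-start j) (m≤m+n (start j) r))) (n<length-X n)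

  image-occurs : ∀ j {w} → φ-letter d (U j) ≡ w → Occurs w (start j)
  image-occurs j refl = occurs-at (φ-letter d (U j)) (λ r lt → U-block j lt)

  U-start : ∀ j → U (start j) ≡ 0
  U-start j with letterImage (U j)
  ... | short _ eq _ = occurs-head (image-occurs j eq)
  ... | long _ eq _  = occurs-head (image-occurs j eq)

  U-second : ∀ j → U (suc (start j)) ≡ σ (U j)
  U-second j with letterImage (U j)
  ... | short _ eq σc = trans (occurs-head (occurs-tail (image-occurs j eq))) (sym σc)
  ... | long _ eq σc  = trans (occurs-head (occurs-tail (image-occurs j eq))) (sym σc)

  data Block (j : ℕ) : Set where
    short : U j < D → start (suc j) ≡ 2 + start j → Block j
    long  : U j ≡ D → U (2 + start j) ≡ D → start (suc j) ≡ 3 + start j → Block j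

  block : ∀ j → Block j
  block j with letterImage (U j)
  ... | short lt eq _ = short lt (trans (cong (λ w → start j + length w) eq) (+-comm (start j) 2))
  ... | long ge eq _  = long (≤-antisym (≤-pred (U<d j)) ge)
    (occurs-head (occurs-tail (occurs-tail (image-occurs j eq))))
    (trans (cong (λ w → start j + length w) eq) (+-comm (start j) 3))

  data Position : ℕ → Set where
    first  : ∀ j → Position (start j)
    second : ∀ j → Position (suc (start j))
    third  : ∀ j → U j ≡ D → Position (2 + start j)

  position : ∀ p → Position p
  position zero = first 0
  position (suc p) with position p
  ... | first j = second j
  ... | second j with block j
  ...   | short _ next   = subst Position next (first (suc j))
  ...   | long uj _ _    = third j uj
  position (suc p) | third j uj with block j
  ...   | short lt _     = ⊥-elim (<⇒≢ lt uj)
  ...   | long _ _ next  = subst Position next (first (suc j))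

  σ≢0 : ∀ c → σ c ≢ 0
  σ≢0 c with letterImage c
  ... | short _ _ σc = λ h → 1+n≢0 (trans (sym σc) h)
  ... | long _ _ σc  = λ h → 1+n≢0 (trans (sym σc) h)

  U-after : ∀ j {k} → start (suc j) ≡ k → U k ≡ 0
  U-after j eq = trans (cong U (sym eq)) (U-start (suc j))

  zero-at-start : ∀ p → U p ≡ 0 → ∃ λ j → p ≡ start j
  zero-at-start p z with position p
  ... | first j    = j , refl
  ... | second j   = ⊥-elim (σ≢0 (U j) (trans (sym (U-second j)) z))
  ... | third j uj with block j
  ...   | short lt _    = ⊥-elim (<⇒≢ lt uj)
  ...   | long _ u₂ _   = ⊥-elim (1+n≢0 (trans (sym u₂) z))

  Adjacent : ℕ → ℕ → Set
  Adjacent a b = (a ≡ 0 × b ≢ 0) ⊎ (a ≢ 0 × b ≡ 0) ⊎ (a ≡ D × b ≡ D)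

  DDFlanked : ℕ → ℕ → ℕ → Set
  DDFlanked a b c = (b ≡ D → c ≡ D → a ≡ 0) × (a ≡ D → b ≡ D → c ≡ 0)

  local : ∀ p → Adjacent (U p) (U (suc p)) × DDFlanked (U p) (U (suc p)) (U (2 + p))
  local p with position p
  ... | first j rewrite U-start j | U-second j =
    inj₁ (refl , σ≢0 (U j)) , (λ _ _ → refl) , (λ ())
  ... | second j with block j
  ...   | short _ next rewrite U-second j | U-after j next =
    inj₂ (inj₁ (σ≢0 (U j) , refl)) , (λ ()) , (λ _ ())
  ...   | long uj u₂ next rewrite U-second j | U-after j next | u₂ | uj | σ-D =
    inj₂ (inj₂ (refl , refl)) , (λ _ ()) , (λ _ _ → refl)
  local p | third j uj with block j
  ...   | short lt _ = ⊥-elim (<⇒≢ lt uj)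
  ...   | long _ u₂ next rewrite u₂ | U-after j next =
    inj₂ (inj₁ ((λ ()) , refl)) , (λ ()) , (λ _ ())

  LocalTriple : ℕ → ℕ → Word → Set
  LocalTriple a b []      = ⊤
  LocalTriple a b (c ∷ _) = DDFlanked a b c

  Local : Word → Set
  Local (a ∷ b ∷ r) = Adjacent a b × LocalTriple a b r × Local (b ∷ r)
  Local _           = ⊤

  Local-adjacent : ∀ {a b r} → Local (a ∷ b ∷ r) → Adjacent a b
  Local-adjacent = proj₁

  Local-triple : ∀ {a b c r} → Local (a ∷ b ∷ c ∷ r) → DDFlanked a b c
  Local-triple l = proj₁ (proj₂ l)

  Local-tail : ∀ a w → Local (a ∷ w) → Local w
  Local-tail a []      _ = tt
  Local-tail a (b ∷ w) l = proj₂ (proj₂ l)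

  Local-++ʳ : ∀ A {B} → Local (A ++ B) → Local B
  Local-++ʳ []      l = l
  Local-++ʳ (a ∷ A) l = Local-++ʳ A (Local-tail a (A ++ _) l)

  Local-slice : ∀ p n → Local (slice p n)
  Local-slice p zero                = tt
  Local-slice p (suc zero)          = tt
  Local-slice p (suc (suc zero))    = proj₁ (local p) , tt , tt
  Local-slice p (suc (suc (suc n))) = proj₁ (local p) , proj₂ (local p) , Local-slice (suc p) (suc (suc n))

  Local-occurs : ∀ {w p} → Occurs w p → Local w
  Local-occurs {w} {p} o = subst Local (sym o) (Local-slice p (length w))

  Adjacent-nonzero-right : ∀ {a b} → Adjacent a b → b ≢ 0 → b ≢ D → a ≡ 0
  Adjacent-nonzero-right (inj₁ (a≡0 , _))        _   _   = a≡0
  Adjacent-nonzero-right (inj₂ (inj₁ (_ , b≡0))) b≢0 _   = ⊥-elim (b≢0 b≡0)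
  Adjacent-nonzero-right (inj₂ (inj₂ (_ , b≡D))) _   b≢D = ⊥-elim (b≢D b≡D)

  Adjacent-nonzero-left : ∀ {a b} → Adjacent a b → a ≢ 0 → a ≢ D → b ≡ 0
  Adjacent-nonzero-left (inj₁ (a≡0 , _))        a≢0 _   = ⊥-elim (a≢0 a≡0)
  Adjacent-nonzero-left (inj₂ (inj₁ (_ , b≡0))) _   _   = b≡0
  Adjacent-nonzero-left (inj₂ (inj₂ (a≡D , _))) _   a≢D = ⊥-elim (a≢D a≡D)

  Adjacent-D-right : ∀ {a} → Adjacent a D → a ≡ 0 ⊎ a ≡ D
  Adjacent-D-right (inj₁ (a≡0 , _))        = inj₁ a≡0
  Adjacent-D-right (inj₂ (inj₁ (_ , ())))
  Adjacent-D-right (inj₂ (inj₂ (a≡D , _))) = inj₂ a≡D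

  Adjacent-D-left : ∀ {b} → Adjacent D b → b ≡ 0 ⊎ b ≡ D
  Adjacent-D-left (inj₁ (() , _))
  Adjacent-D-left (inj₂ (inj₁ (_ , b≡0))) = inj₁ b≡0
  Adjacent-D-left (inj₂ (inj₂ (_ , b≡D))) = inj₂ b≡D

  start-+ : ∀ j n → start (j + n) ≡ start j + length (φ d (slice j n))
  start-+ j zero    = trans (cong start (+-identityʳ j)) (sym (+-identityʳ (start j)))
  start-+ j (suc n) = begin
    start (j + suc n)                                          ≡⟨ cong start (+-suc j n) ⟩
    start (suc j + n)                                          ≡⟨ start-+ (suc j) n ⟩
    (start j + len (U j)) + length (φ d (slice (suc j) n))     ≡⟨ +-assoc (start j) _ _ ⟩
    start j + (len (U j) + length (φ d (slice (suc j) n)))     ≡⟨ cong (start j +_) (sym (length-++ (φ-letter d (U j)))) ⟩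
    start j + length (φ d (slice j (suc n)))                   ∎
    where open ≡-Reasoning

  φ-slice-occurs : ∀ j n → Occurs (φ d (slice j n)) (start j)
  φ-slice-occurs j zero    = refl
  φ-slice-occurs j (suc n) = occurs-++⁺ (φ-letter d (U j)) (image-occurs j refl) (φ-slice-occurs (suc j) n)

  φ-prefix : ∀ n → φ d (slice 0 n) ≡ slice 0 (start n)
  φ-prefix n = trans (φ-slice-occurs 0 n) (cong (slice 0) (sym (start-+ 0 n)))

  recurrence-φ : ∀ {n q} → slice 0 n ≡ slice q n → slice 0 (start n) ≡ slice (start q) (start n)
  recurrence-φ {n} {q} eq = begin
    slice 0 (start n)                          ≡⟨ sym (φ-prefix n) ⟩
    φ d (slice 0 n)                            ≡⟨ cong (φ d) eq ⟩
    φ d (slice q n)                            ≡⟨ φ-slice-occurs q n ⟩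
    slice (start q) (length (φ d (slice q n))) ≡⟨ cong (λ v → slice (start q) (length (φ d v))) (sym eq) ⟩
    slice (start q) (length (φ d (slice 0 n))) ≡⟨ cong (slice (start q)) (sym (start-+ 0 n)) ⟩
    slice (start q) (start n)                  ∎
    where open ≡-Reasoning

  prefix-recurs : ∀ n → ∃ λ q → 0 < q × slice 0 n ≡ slice q n
  prefix-recurs zero          = 1 , s≤s z≤n , refl
  prefix-recurs (suc zero)    = start 1 , start-<-suc 0 , cong (_∷ []) (trans (U-start 0) (sym (U-start 1)))
  prefix-recurs (suc (suc n)) with prefix-recurs (suc n)
  ... | q , q>0 , eq = start q , start-mono-< q>0 , slice-prefix (suc (suc n)) (2+≤-start n) (recurrence-φ eq)

  record Ext (w : Word) : Set where
    constructor ext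
    field
      left right pos : ℕ
      occurs : Occurs (left ∷ w ++ right ∷ []) pos

  open Ext

  ext-local : ∀ {w} (ε : Ext w) → Local (left ε ∷ w ++ right ε ∷ [])
  ext-local ε = Local-occurs (occurs ε)

  ext-inner : ∀ {w} (ε : Ext w) → Occurs w (suc (pos ε))
  ext-inner {w} ε = proj₁ (occurs-++⁻ w (occurs-tail (occurs ε)))

  left<d : ∀ {w} (ε : Ext w) → left ε < d
  left<d ε = subst (_< d) (occurs-head (occurs ε)) (U<d (pos ε))

  right<d : ∀ {w} (ε : Ext w) → right ε < d
  right<d {w} ε with occurs-++⁻ (left ε ∷ w) (occurs ε)
  ... | _ , o = subst (_< d) (occurs-head o) (U<d _)

  record Bispecial₂ (w : Word) : Set where
    constructor bispecial
    field
      l₁ l₂ r₁ r₂ : Ext w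
      left-≢  : left l₁ ≢ left l₂
      right-≢ : right r₁ ≢ right r₂

  open Bispecial₂

  extend-right : ∀ {a w p} → Occurs (a ∷ w) p → Ext w
  extend-right {a} {w} {p} o = ext a (U (p + length (a ∷ w))) p (occurs-++⁺ (a ∷ w) o refl)

  -- An occurrence at 0 is a prefix of u, which recurs later.
  occurs-positive : ∀ {w} p → Occurs w p → ∃ λ q → Occurs w (suc q)
  occurs-positive     (suc p) o = p , o
  occurs-positive {w} zero    o with prefix-recurs (length w)
  ... | suc q , _ , eq = q , trans o eq

  extend-left : ∀ {w b p} → Occurs (w ++ b ∷ []) p → Ext w
  extend-left {w} {b} {p} o = ext (U q) b q (occurs-∷ refl (proj₂ preceded))
    where
      preceded = occurs-positive p o
      q = proj₁ preceded

  Bispecial⇒Bispecial₂ : ∀ w → Bispecial d w → Bispecial₂ w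
  Bispecial⇒Bispecial₂ w ((a , a' , a≢a' , (p , o) , (p' , o')) , (b , b' , b≢b' , (q , o₂) , (q' , o₂'))) =
    bispecial (extend-right (OccursAt⇒Occurs (a ∷ w) p o))
              (extend-right (OccursAt⇒Occurs (a' ∷ w) p' o'))
              (extend-left (OccursAt⇒Occurs (w ++ b ∷ []) q o₂))
              (extend-left (OccursAt⇒Occurs (w ++ b' ∷ []) q' o₂'))
              a≢a' b≢b'

  not-left-forced : ∀ {w c} → Bispecial₂ w → ¬ (∀ (ε : Ext w) → left ε ≡ c)
  not-left-forced bs h = left-≢ bs (trans (h (l₁ bs)) (sym (h (l₂ bs))))

  not-right-forced : ∀ {w c} → Bispecial₂ w → ¬ (∀ (ε : Ext w) → right ε ≡ c)
  not-right-forced bs h = right-≢ bs (trans (h (r₁ bs)) (sym (h (r₂ bs))))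

  -- The shape of bispecial factors

  data Pad : Word → Set where
    none : Pad []
    top  : Pad (D ∷ [])

  ZeroEnds : Word → Set
  ZeroEnds z = (∃ λ z' → z ≡ 0 ∷ z') × (∃ λ z' → z ≡ z' ++ 0 ∷ [])

  data Shape : Word → Set where
    empty  : Shape []
    single : Shape (D ∷ [])
    padded : ∀ {P S} z → Pad P → Pad S → ZeroEnds z → Shape (P ++ z ++ S)

  ∷ʳ0-starts-with-0 : ∀ t {S z'} → (t ++ 0 ∷ []) ++ S ≡ 0 ∷ z' → ∃ λ z'' → t ++ 0 ∷ [] ≡ 0 ∷ z''
  ∷ʳ0-starts-with-0 []      _  = [] , refl
  ∷ʳ0-starts-with-0 (a ∷ t) eq = t ++ 0 ∷ [] , cong (_∷ t ++ 0 ∷ []) (∷-injectiveˡ eq)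

  ++-snoc³ : ∀ t (a b c : ℕ) → ((t ++ a ∷ []) ++ b ∷ []) ++ c ∷ [] ≡ t ++ a ∷ b ∷ c ∷ []
  ++-snoc³ t a b c = trans (++-assoc (t ++ a ∷ []) (b ∷ []) (c ∷ [])) (++-assoc t (a ∷ []) (b ∷ c ∷ []))

  suffix-shape : ∀ rest {z'} → rest ≡ 0 ∷ z' → ∀ {y₁ y₂} → y₁ ≢ y₂ →
                 Local (rest ++ y₁ ∷ []) → Local (rest ++ y₂ ∷ []) →
                 Σ Word λ z → Σ Word λ S → rest ≡ z ++ S × Pad S × ZeroEnds z
  suffix-shape rest eq y₁≢y₂ l₁ l₂ with initLast rest
  suffix-shape .[] () y₁≢y₂ l₁ l₂ | []
  ... | ys ∷ʳ′ l with l ≟ 0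
  ...   | yes refl = ys ++ 0 ∷ [] , [] , sym (++-identityʳ _) , none , (_ , eq) , (ys , refl)
  ...   | no l≢0 with l ≟ D
  ...     | no l≢D = ⊥-elim (y₁≢y₂ (trans (forced l₁) (sym (forced l₂))))
    where
      forced : ∀ {y} → Local ((ys ++ l ∷ []) ++ y ∷ []) → y ≡ 0
      forced {y} lc = Adjacent-nonzero-left
        (Local-adjacent (Local-++ʳ ys (subst Local (++-assoc ys (l ∷ []) (y ∷ [])) lc))) l≢0 l≢D
  ...     | yes refl with initLast ys
  ...       | [] = ⊥-elim (1+n≢0 (∷-injectiveˡ eq))
  ...       | ys' ∷ʳ′ k with Adjacent-D-right (Local-adjacent (Local-++ʳ ys' (subst Local (++-snoc³ ys' k D _) l₁)))
  ...         | inj₁ refl = ys' ++ 0 ∷ [] , D ∷ [] , refl , top , ∷ʳ0-starts-with-0 ys' eq , (ys' , refl)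
  ...         | inj₂ refl = ⊥-elim (y₁≢y₂ (trans (forced l₁) (sym (forced l₂))))
    where
      forced : ∀ {y} → Local (((ys' ++ D ∷ []) ++ D ∷ []) ++ y ∷ []) → y ≡ 0
      forced {y} lc = proj₂ (Local-triple (Local-++ʳ ys' (subst Local (++-snoc³ ys' D D y) lc))) refl refl

  Local-after : ∀ P {R} (ε : Ext (P ++ R)) → Local (R ++ right ε ∷ [])
  Local-after P {R} ε =
    Local-++ʳ (left ε ∷ P) (subst Local (cong (left ε ∷_) (++-assoc P R (right ε ∷ []))) (ext-local ε))

  shape-after-pad : ∀ {P} → Pad P → ∀ r → Bispecial₂ (P ++ 0 ∷ r) → Shape (P ++ 0 ∷ r)
  shape-after-pad {P} pad r bs
    with suffix-shape (0 ∷ r) refl (right-≢ bs) (Local-after P (r₁ bs)) (Local-after P (r₂ bs))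
  ... | z , S , eq , padS , ends = subst Shape (cong (P ++_) (sym eq)) (padded z pad padS ends)

  -- A letter other than 0 and D, as well as DD, forces its neighbours to be 0; so a bispecial factor
  -- begins with 0 or D0 and ends with 0 or 0D.
  shape : ∀ w → Bispecial₂ w → Shape w
  shape []      _  = empty
  shape (c ∷ r) bs with c ≟ 0
  ... | yes refl = shape-after-pad none r bs
  ... | no c≢0 with c ≟ D
  ...   | no c≢D = ⊥-elim (not-left-forced bs λ ε →
            Adjacent-nonzero-right (Local-adjacent (ext-local ε)) c≢0 c≢D)
  ...   | yes refl with r
  ...     | []      = single
  ...     | c₂ ∷ r₂ with Adjacent-D-left (Local-adjacent (Local-tail _ _ (ext-local (l₁ bs))))
  ...       | inj₁ refl = shape-after-pad top r₂ bs
  ...       | inj₂ refl = ⊥-elim (not-left-forced bs λ ε → proj₁ (Local-triple (ext-local ε)) refl refl)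

  -- Desubstitution

  -- Flank P x₀ x says that x follows 0P in φ(x₀)0. As φ(x₀)0 is a palindrome, this describes
  -- the letters on both sides of an occurrence of P φ(v)0 S.
  Flank : Word → ℕ → ℕ → Set
  Flank []      x₀ x = x ≡ σ x₀
  Flank (_ ∷ _) x₀ x = (x₀ ≡ e × x ≡ 0) ⊎ (x₀ ≡ D × x ≡ D)

  Flank-functional : ∀ {P x₀ x x'} → Pad P → Flank P x₀ x → Flank P x₀ x' → x ≡ x'
  Flank-functional none fl fl'                           = trans fl (sym fl')
  Flank-functional top (inj₁ (_ , x≡0)) (inj₁ (_ , x'≡0)) = trans x≡0 (sym x'≡0)
  Flank-functional top (inj₁ (refl , _)) (inj₂ (() , _))
  Flank-functional top (inj₂ (refl , _)) (inj₁ (() , _))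
  Flank-functional top (inj₂ (_ , x≡D)) (inj₂ (_ , x'≡D)) = trans x≡D (sym x'≡D)

  Flank-top-inner : ∀ {x₀ x} → Flank (D ∷ []) x₀ x → x₀ ≡ e ⊎ x₀ ≡ D
  Flank-top-inner (inj₁ (x₀≡e , _)) = inj₁ x₀≡e
  Flank-top-inner (inj₂ (x₀≡D , _)) = inj₂ x₀≡D

  Flank-top-outer : ∀ {x₀ x} → Flank (D ∷ []) x₀ x → x ≡ 0 ⊎ x ≡ D
  Flank-top-outer (inj₁ (_ , x≡0)) = inj₁ x≡0
  Flank-top-outer (inj₂ (_ , x≡D)) = inj₂ x≡D

  Flank-top-D : ∀ {x} → Flank (D ∷ []) D x → x ≡ D
  Flank-top-D (inj₁ (() , _))
  Flank-top-D (inj₂ (_ , x≡D)) = x≡D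

  σ≡D⇒≡e : ∀ {c} → c < D → σ c ≡ D → c ≡ e
  σ≡D⇒≡e lt h = suc-injective (trans (sym (σ-< lt)) h)

  data BlockEnd (J : ℕ) : ℕ → Set where
    short-end : U J < D → BlockEnd J (suc (start J))
    long-end  : U J ≡ D → U (2 + start J) ≡ D → BlockEnd J (2 + start J)

  before-start : ∀ {j p} → suc p ≡ start j → ∃ λ J → j ≡ suc J × BlockEnd J p
  before-start {suc J} eq with block J
  ... | short lt next   = J , refl , subst (BlockEnd J) (sym (suc-injective (trans eq next))) (short-end lt)
  ... | long uj u₂ next = J , refl , subst (BlockEnd J) (sym (suc-injective (trans eq next))) (long-end uj u₂)

  U-block-end : ∀ {J p} → BlockEnd J p → U p ≡ σ (U J)
  U-block-end {J} (short-end _)    = U-second J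
  U-block-end     (long-end uj u₂) = trans u₂ (trans (sym σ-D) (cong σ (sym uj)))

  left-flank : ∀ {P x p} j → Pad P → Occurs (x ∷ P) p → p + length (x ∷ P) ≡ start j →
               ∃ λ J → j ≡ suc J × Flank P (U J) x
  left-flank {p = p} _ none o eq with before-start (trans (+-comm 1 p) eq)
  ... | J , j≡ , end = J , j≡ , trans (sym (occurs-head o)) (U-block-end end)
  left-flank {p = p} _ top o eq with before-start (trans (+-comm 2 p) eq)
  ... | J , j≡ , short-end lt =
    J , j≡ , inj₁ (σ≡D⇒≡e lt (trans (sym (U-second J)) (occurs-head (occurs-tail o))) ,
                   trans (sym (occurs-head o)) (U-start J))
  ... | J , j≡ , long-end uj _ =
    J , j≡ , inj₂ (uj , trans (sym (occurs-head o)) (trans (U-second J) (trans (cong σ uj) σ-D)))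

  right-flank : ∀ {S y} j → Pad S → Occurs (S ++ y ∷ []) (suc (start j)) → Flank S (U j) y
  right-flank j none o = trans (sym (occurs-head o)) (U-second j)
  right-flank j top  o with block j
  ... | short lt next =
    inj₁ (σ≡D⇒≡e lt (trans (sym (U-second j)) (occurs-head o)) ,
          trans (sym (occurs-head (occurs-tail o))) (U-after j next))
  ... | long uj u₂ _  = inj₂ (uj , trans (sym (occurs-head (occurs-tail o))) u₂)

  image-position : ∀ {z zm zm' q} → z ≡ 0 ∷ zm → z ≡ zm' ++ 0 ∷ [] → Occurs z q →
    ∃ λ j → ∃ λ n → q ≡ start j × start (j + n) ≡ q + length zm' × zm' ≡ φ d (slice j n)
  image-position {zm' = zm'} {q} e₁ e₂ o
    with zero-at-start q (occurs-head (subst (λ t → Occurs t q) e₁ o))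
       | occurs-++⁻ zm' (subst (λ t → Occurs t q) e₂ o)
  ... | j , refl | o-zm' , o-0 with zero-at-start (start j + length zm') (occurs-head o-0)
  ... | j' , end
    with m≤n⇒∃[o]m+o≡n (start-cancel-≤ {j} {j'} (≤-trans (m≤m+n (start j) (length zm')) (≤-reflexive end)))
  ... | n , refl = j , n , refl , sym end , occurs-unique o-zm' (φ-slice-occurs j n) same-length
    where
      same-length : length zm' ≡ length (φ d (slice j n))
      same-length = +-cancelˡ-≡ (start j) _ _ (trans end (start-+ j n))

  Lifts : ∀ P S {v w} → Ext v → Ext w → Set
  Lifts P S ε₀ ε = Flank P (left ε₀) (left ε) × Flank S (right ε₀) (right ε)

  Desubst : Word → Word → Word → Word → Set
  Desubst P S v w = ∀ (ε : Ext w) → Σ (Ext v) λ ε₀ → Lifts P S ε₀ ε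

  desubstitute : ∀ {P z S} → Pad P → Pad S → ZeroEnds z → (ε : Ext (P ++ z ++ S)) →
    Σ Word λ v → φ d v ++ 0 ∷ [] ≡ z × Σ (Ext v) λ ε₀ → Lifts P S ε₀ ε
  desubstitute {P} {z} {S} padP padS ((zm , e₁) , (zm' , e₂)) (ext x y p o)
    with occurs-++⁻ (x ∷ P) (subst (λ t → Occurs t p) regroup o)
    where
      regroup : x ∷ (P ++ z ++ S) ++ y ∷ [] ≡ (x ∷ P) ++ z ++ S ++ y ∷ []
      regroup = cong (x ∷_) (trans (++-assoc P (z ++ S) (y ∷ [])) (cong (P ++_) (++-assoc z S (y ∷ []))))
  ... | oP , oR with occurs-++⁻ z oR
  ... | oz , oSy with image-position e₁ e₂ oz
  ... | j , n , q≡ , end≡ , zm'≡ with left-flank j padP oP q≡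
  ... | J , refl , flankL =
    slice (suc J) n , image , ext (U J) (U (suc J + n)) J occ , flankL ,
    right-flank (suc J + n) padS (subst (Occurs (S ++ y ∷ [])) after-z oSy)
    where
      q = p + length (x ∷ P)
      image : φ d (slice (suc J) n) ++ 0 ∷ [] ≡ z
      image = trans (cong (_++ 0 ∷ []) (sym zm'≡)) (sym e₂)
      occ : Occurs (U J ∷ slice (suc J) n ++ U (suc J + n) ∷ []) J
      occ = occurs-∷ refl (occurs-++⁺ (slice (suc J) n) (occurs-slice (suc J) n)
                                      (cong (λ k → U (suc J + k) ∷ []) (sym (length-slice (suc J) n))))
      after-z : q + length z ≡ suc (start (suc J + n))
      after-z = begin
        q + length z                 ≡⟨ cong (λ t → q + length t) e₂ ⟩
        q + length (zm' ++ 0 ∷ [])   ≡⟨ cong (q +_) (length-++ zm') ⟩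
        q + (length zm' + 1)         ≡⟨ sym (+-assoc q (length zm') 1) ⟩
        (q + length zm') + 1         ≡⟨ cong (_+ 1) (sym end≡) ⟩
        start (suc J + n) + 1        ≡⟨ +-comm _ 1 ⟩
        suc (start (suc J + n))      ∎
        where open ≡-Reasoning

  φ-not-D : ∀ v {t} → φ d v ≢ D ∷ t
  φ-not-D []      ()
  φ-not-D (c ∷ v) h with letterImage c
  ... | short _ eq _ rewrite eq = 0≢1+n (∷-injectiveˡ h)
  ... | long _ eq _  rewrite eq = 0≢1+n (∷-injectiveˡ h)

  φ-∷≢[] : ∀ c v → φ d (c ∷ v) ≢ []
  φ-∷≢[] c v h with subst (2 ≤_) (cong length h) (≤-trans (2≤len c) (length-++-≤ˡ (φ-letter d c)))
  ... | ()

  φ-injective : ∀ {v v'} → All (_< d) v → All (_< d) v' → φ d v ≡ φ d v' → v ≡ v'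
  φ-injective [] [] _ = refl
  φ-injective {v' = c' ∷ v'} [] _ h = ⊥-elim (φ-∷≢[] c' v' (sym h))
  φ-injective {v = c ∷ v}    _ [] h = ⊥-elim (φ-∷≢[] c v h)
  φ-injective {c ∷ v} {c' ∷ v'} (c<d ∷ v<d) (c'<d ∷ v'<d) h with letterImage c | letterImage c'
  ... | short _ eq _ | short _ eq' _ rewrite eq | eq' =
    cong₂ _∷_ (suc-injective (∷-injectiveˡ (∷-injectiveʳ h)))
              (φ-injective v<d v'<d (∷-injectiveʳ (∷-injectiveʳ h)))
  ... | long ge eq _ | long ge' eq' _ rewrite eq | eq' =
    cong₂ _∷_ (trans (≤-antisym (≤-pred c<d) ge) (sym (≤-antisym (≤-pred c'<d) ge')))
              (φ-injective v<d v'<d (∷-injectiveʳ (∷-injectiveʳ (∷-injectiveʳ h))))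
  ... | short _ eq _ | long _ eq' _ rewrite eq | eq' = ⊥-elim (φ-not-D v (∷-injectiveʳ (∷-injectiveʳ h)))
  ... | long _ eq _ | short _ eq' _ rewrite eq | eq' = ⊥-elim (φ-not-D v' (sym (∷-injectiveʳ (∷-injectiveʳ h))))

  Bispecial₂-desubst : ∀ {P S v w} → Pad P → Pad S → Desubst P S v w → Bispecial₂ w → Bispecial₂ v
  Bispecial₂-desubst {P} {S} padP padS ds bs =
    bispecial (lift (l₁ bs)) (lift (l₂ bs)) (lift (r₁ bs)) (lift (r₂ bs)) left-≢′ right-≢′
    where
      lift = λ ε → proj₁ (ds ε)
      left-≢′ : left (lift (l₁ bs)) ≢ left (lift (l₂ bs))
      left-≢′ eq = left-≢ bs (Flank-functional padP (proj₁ (proj₂ (ds (l₁ bs))))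
                     (subst (λ t → Flank P t (left (l₂ bs))) (sym eq) (proj₁ (proj₂ (ds (l₂ bs))))))
      right-≢′ : right (lift (r₁ bs)) ≢ right (lift (r₂ bs))
      right-≢′ eq = right-≢ bs (Flank-functional padS (proj₂ (proj₂ (ds (r₁ bs))))
                      (subst (λ t → Flank S t (right (r₂ bs))) (sym eq) (proj₂ (proj₂ (ds (r₂ bs))))))

  -- The preimage v is unique since φ is injective; so one v serves all extensions.
  desubstitution : ∀ {P z S} → Pad P → Pad S → ZeroEnds z → Ext (P ++ z ++ S) →
    Σ Word λ v → φ d v ++ 0 ∷ [] ≡ z × Desubst P S v (P ++ z ++ S)
  desubstitution {P} {z} {S} padP padS ends ε with desubstitute padP padS ends ε
  ... | v , image , ε₀ , _ = v , image , λ ε' → aligned ε' (desubstitute padP padS ends ε')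
    where
      aligned : ∀ ε' → (Σ Word λ v' → φ d v' ++ 0 ∷ [] ≡ z × Σ (Ext v') λ ε₀' → Lifts P S ε₀' ε') →
                Σ (Ext v) λ ε₀' → Lifts P S ε₀' ε'
      aligned ε' (v' , image' , ε₀' , lifts)
        with φ-injective (occurs-< (ext-inner ε₀')) (occurs-< (ext-inner ε₀))
                         (∷ʳ-injectiveˡ (φ d v') (φ d v) (trans image' (sym image)))
      ... | refl = ε₀' , lifts

  shorter : ∀ P S v → length v < length (P ++ (φ d v ++ 0 ∷ []) ++ S)
  shorter P S v = begin-strict
    length v                                ≤⟨ m≤m+n (length v) (length v) ⟩
    length v + length v                     ≤⟨ length-φ-≥ v ⟩
    length (φ d v)                          <⟨ ≤-reflexive (trans (+-comm 1 _) (sym (length-++ (φ d v)))) ⟩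
    length (φ d v ++ 0 ∷ [])                ≤⟨ length-++-≤ˡ (φ d v ++ 0 ∷ []) ⟩
    length ((φ d v ++ 0 ∷ []) ++ S)         ≤⟨ length-++-≤ʳ ((φ d v ++ 0 ∷ []) ++ S) {P} ⟩
    length (P ++ (φ d v ++ 0 ∷ []) ++ S)    ∎
    where open ≤-Reasoning

  -- Central words and the orbits of f

  -- The central words are the bispecial factors on the orbit of T₀.
  central : ℕ → Word
  central zero    = []
  central (suc j) = φ d (central j) ++ 0 ∷ []

  φ-letter-palindrome : ∀ c → 0 ∷ reverse (φ-letter d c) ≡ φ-letter d c ++ 0 ∷ []
  φ-letter-palindrome c with letterImage c
  ... | short _ eq _ rewrite eq = refl
  ... | long _ eq _  rewrite eq = refl

  reverse-φ : ∀ v → 0 ∷ reverse (φ d v) ≡ φ d (reverse v) ++ 0 ∷ []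
  reverse-φ []      = refl
  reverse-φ (c ∷ v) = begin
    0 ∷ reverse (φ-letter d c ++ φ d v)                  ≡⟨ cong (0 ∷_) (reverse-++ (φ-letter d c) (φ d v)) ⟩
    (0 ∷ reverse (φ d v)) ++ reverse (φ-letter d c)      ≡⟨ cong (_++ reverse (φ-letter d c)) (reverse-φ v) ⟩
    (φ d (reverse v) ++ 0 ∷ []) ++ reverse (φ-letter d c) ≡⟨ ++-assoc (φ d (reverse v)) (0 ∷ []) _ ⟩
    φ d (reverse v) ++ 0 ∷ reverse (φ-letter d c)        ≡⟨ cong (φ d (reverse v) ++_) (φ-letter-palindrome c) ⟩
    φ d (reverse v) ++ φ-letter d c ++ 0 ∷ []            ≡⟨ sym (++-assoc (φ d (reverse v)) (φ-letter d c) _) ⟩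
    (φ d (reverse v) ++ φ-letter d c) ++ 0 ∷ []          ≡⟨ cong (λ t → (φ d (reverse v) ++ t) ++ 0 ∷ []) (sym (++-identityʳ _)) ⟩
    (φ d (reverse v) ++ φ d (c ∷ [])) ++ 0 ∷ []          ≡⟨ cong (_++ 0 ∷ []) (sym (φ-++ (reverse v) (c ∷ []))) ⟩
    φ d (reverse v ++ c ∷ []) ++ 0 ∷ []                  ≡⟨ cong (λ t → φ d t ++ 0 ∷ []) (sym (unfold-reverse c v)) ⟩
    φ d (reverse (c ∷ v)) ++ 0 ∷ []                      ∎
    where open ≡-Reasoning

  reverse-image : ∀ v → reverse (φ d v ++ 0 ∷ []) ≡ φ d (reverse v) ++ 0 ∷ []
  reverse-image v = trans (reverse-++ (φ d v) (0 ∷ [])) (reverse-φ v)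

  central-palindrome : ∀ j → reverse (central j) ≡ central j
  central-palindrome zero    = refl
  central-palindrome (suc j) = trans (reverse-image (central j)) (cong (λ t → φ d t ++ 0 ∷ []) (central-palindrome j))

  reverse-padded : ∀ {P S} z → Pad P → Pad S → reverse (P ++ z ++ S) ≡ S ++ reverse z ++ P
  reverse-padded {P} {S} z padP padS = begin
    reverse (P ++ z ++ S)                   ≡⟨ reverse-++ P (z ++ S) ⟩
    reverse (z ++ S) ++ reverse P           ≡⟨ cong (_++ reverse P) (reverse-++ z S) ⟩
    (reverse S ++ reverse z) ++ reverse P   ≡⟨ cong₂ (λ s p → (s ++ reverse z) ++ p) (reverse-pad padS) (reverse-pad padP) ⟩
    (S ++ reverse z) ++ P                   ≡⟨ ++-assoc S (reverse z) P ⟩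
    S ++ reverse z ++ P                     ∎
    where
      open ≡-Reasoning
      reverse-pad : ∀ {Q} → Pad Q → reverse Q ≡ Q
      reverse-pad none = refl
      reverse-pad top  = refl

  ≡ᵇ-false : ∀ {a b} → a ≢ b → (a ≡ᵇ b) ≡ false
  ≡ᵇ-false {a} {b} a≢b with a ≡ᵇ b in eq
  ... | false = refl
  ... | true  = ⊥-elim (a≢b (≡ᵇ⇒≡ a b (subst True (sym eq) _)))

  ≡ᵇ-refl : ∀ a → (a ≡ᵇ a) ≡ true
  ≡ᵇ-refl a with a ≡ᵇ a in eq
  ... | true  = refl
  ... | false = ⊥-elim (subst True eq (≡⇒≡ᵇ a a refl))

  -- The letter that f adds on the side of a triple carrying the letter a.
  padFor : ℕ → Word
  padFor a = if a ≡ᵇ e then D ∷ [] else []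

  suc-%-< : ∀ {a} → a < e → suc a % D ≡ suc a
  suc-%-< a<e = m<n⇒m%n≡m (s≤s a<e)

  suc-e-% : suc e % D ≡ 0
  suc-e-% = n%n≡0 D

  f^-T-central : ∀ k n → n + k ≤ e → f^ d n (T d k) ≡ (n , central n , n + k)
  f^-T-central k zero    le rewrite ≡ᵇ-false {k} {D} (<⇒≢ (s≤s le)) = refl
  f^-T-central k (suc n) le
    rewrite f^-T-central k n (≤-trans (n≤1+n _) le)
          | ≡ᵇ-false {n} {e} (<⇒≢ (≤-trans (s≤s (m≤m+n n k)) le))
          | ≡ᵇ-false {n + k} {e} (<⇒≢ le)
          | suc-%-< (≤-trans (s≤s (m≤m+n n k)) le)
          | suc-%-< le
          | ++-identityʳ (φ d (central n) ++ 0 ∷ []) = refl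

  f^-T-branch : ∀ j → j < e → f^ d (suc j) (T d (e ∸ j)) ≡ (suc j , central (suc j) ++ D ∷ [] , 0)
  f^-T-branch j j<e
    rewrite f^-T-central (e ∸ j) j (≤-reflexive (m+[n∸m]≡n (<⇒≤ j<e)))
          | m+[n∸m]≡n (<⇒≤ j<e)
          | ≡ᵇ-false (<⇒≢ j<e) | ≡ᵇ-refl e | suc-%-< j<e | suc-e-% = refl

  f^-T-top : f^ d (suc e) (T d 0) ≡ (0 , D ∷ central (suc e) ++ D ∷ [] , 0)
  f^-T-top = trans (cong (f d) (trans (f^-T-central 0 e (≤-reflexive (+-identityʳ e)))
                                      (cong (λ k → e , central e , k) (+-identityʳ e))))
                   f-e-e
    where
      f-e-e : f d (e , central e , e) ≡ (0 , D ∷ central (suc e) ++ D ∷ [] , 0)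
      f-e-e rewrite ≡ᵇ-refl e | suc-e-% = refl

  T-D : T d D ≡ (0 , D ∷ [] , 0)
  T-D rewrite ≡ᵇ-refl D = refl

  data CentralExt (j x y : ℕ) : Set where
    left-j  : x ≡ j → j < y → CentralExt j x y
    right-j : y ≡ j → j < x → CentralExt j x y
    both-D  : x ≡ D → y ≡ D → CentralExt j x y

  CentralExt-swap : ∀ {j x y} → CentralExt j x y → CentralExt j y x
  CentralExt-swap (left-j x≡j j<y)  = right-j x≡j j<y
  CentralExt-swap (right-j y≡j j<x) = left-j y≡j j<x
  CentralExt-swap (both-D x≡D y≡D)  = both-D y≡D x≡D

  CentralExt-e : ∀ {x y} → x < d → CentralExt e x y → x ≡ e ⊎ x ≡ D
  CentralExt-e _   (left-j x≡e _)  = inj₁ x≡e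
  CentralExt-e x<d (right-j _ e<x) = inj₂ (≤-antisym (≤-pred x<d) e<x)
  CentralExt-e _   (both-D x≡D _)  = inj₂ x≡D

  CentralExt-< : ∀ {j x y} → j < e → CentralExt j x y → x ≡ e ⊎ x ≡ D → y ≡ j ⊎ (x ≡ D × y ≡ D)
  CentralExt-< j<e (left-j refl _)  (inj₁ refl) = ⊥-elim (<-irrefl refl j<e)
  CentralExt-< j<e (left-j refl _)  (inj₂ refl) = ⊥-elim (<-irrefl refl (m<n⇒m<1+n j<e))
  CentralExt-< _   (right-j y≡j _)  _           = inj₁ y≡j
  CentralExt-< _   (both-D x≡D y≡D) _           = inj₂ (x≡D , y≡D)

  σ-e-or-D : ∀ {x} → x ≡ e ⊎ x ≡ D → σ x ≡ D
  σ-e-or-D (inj₁ refl) = σ-< (n<1+n e)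
  σ-e-or-D (inj₂ refl) = σ-D

  σ-above : ∀ {j y} → j < e → j < y → suc j < σ y
  σ-above {y = y} j<e j<y with letterImage y
  ... | short _ _ σy rewrite σy = s≤s j<y
  ... | long _ _ σy  rewrite σy = s≤s j<e

  CentralExt-σ : ∀ {j x y} → j < e → CentralExt j x y → CentralExt (suc j) (σ x) (σ y)
  CentralExt-σ j<e (left-j refl j<y)  = left-j (σ-< (m<n⇒m<1+n j<e)) (σ-above j<e j<y)
  CentralExt-σ j<e (right-j refl j<x) = right-j (σ-< (m<n⇒m<1+n j<e)) (σ-above j<e j<x)
  CentralExt-σ j<e (both-D refl refl) = both-D σ-D σ-D

  Adjacent⇒CentralExt-0 : ∀ {x y} → Adjacent x y → CentralExt 0 x y
  Adjacent⇒CentralExt-0 (inj₁ (x≡0 , y≢0))        = left-j x≡0 (n≢0⇒n>0 y≢0)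
  Adjacent⇒CentralExt-0 (inj₂ (inj₁ (x≢0 , y≡0))) = right-j y≡0 (n≢0⇒n>0 x≢0)
  Adjacent⇒CentralExt-0 (inj₂ (inj₂ (x≡D , y≡D))) = both-D x≡D y≡D

  CornerExt : ℕ → ℕ → ℕ → ℕ → Set
  CornerExt a b x y = (x ≡ a ⊎ x ≡ D) × (y ≡ b ⊎ y ≡ D)

  InOrbit : Triple → Set
  InOrbit t = ∃ λ k → ∃ λ n → k < d × f^ d n (T d k) ≡ t

  InOrbit-f : ∀ {t} → InOrbit t → InOrbit (f d t)
  InOrbit-f (k , n , k<d , eq) = k , suc n , k<d , cong (f d) eq

  -- The invariant of the induction on the length of a bispecial factor.
  data Class (w : Word) : Set where
    central-class : ∀ j → j ≤ e → w ≡ central j →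
                    (∀ (ε : Ext w) → CentralExt j (left ε) (right ε)) → Class w
    corner-class  : ∀ a b → a < D → b < D →
                    (∀ (ε : Ext w) → CornerExt a b (left ε) (right ε)) →
                    InOrbit (a , w , b) ⊎ InOrbit (b , reverse w , a) → Class w

  central-step-e : ∀ {P S} → Pad P → Pad S → let w = P ++ central (suc e) ++ S in
    Bispecial₂ w → Desubst P S (central e) w →
    (∀ (ε₀ : Ext (central e)) → CentralExt e (left ε₀) (right ε₀)) → Class w
  central-step-e none _ bs ds bound = ⊥-elim (not-left-forced bs λ ε →
    let (ε₀ , fl , _) = ds ε in trans fl (σ-e-or-D (CentralExt-e (left<d ε₀) (bound ε₀))))
  central-step-e top none bs ds bound = ⊥-elim (not-right-forced bs λ ε →
    let (ε₀ , _ , fr) = ds ε in trans fr (σ-e-or-D (CentralExt-e (right<d ε₀) (CentralExt-swap (bound ε₀)))))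
  central-step-e top top bs ds bound =
    corner-class 0 0 (s≤s z≤n) (s≤s z≤n)
      (λ ε → let (_ , fl , fr) = ds ε in Flank-top-outer fl , Flank-top-outer fr)
      (inj₁ (0 , suc e , s≤s z≤n , f^-T-top))

  central-step-< : ∀ {P S j} → j < e → Pad P → Pad S → let w = P ++ central (suc j) ++ S in
    Bispecial₂ w → Desubst P S (central j) w →
    (∀ (ε₀ : Ext (central j)) → CentralExt j (left ε₀) (right ε₀)) → Class w
  central-step-< {j = j} j<e none none bs ds bound =
    central-class (suc j) j<e (++-identityʳ _) λ ε →
      let (ε₀ , fl , fr) = ds ε in subst₂ (CentralExt (suc j)) (sym fl) (sym fr) (CentralExt-σ j<e (bound ε₀))
  central-step-< {j = j} j<e top none bs ds bound =
    corner-class 0 (suc j) (s≤s z≤n) (s≤s j<e) extensions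
      (inj₂ (e ∸ j , suc j , s≤s (≤-trans (m∸n≤m e j) (n≤1+n e)) ,
             trans (f^-T-branch j j<e) (cong (λ t → suc j , t , 0) (sym reversed))))
    where
      extensions : ∀ ε → CornerExt 0 (suc j) (left ε) (right ε)
      extensions ε with ds ε
      ... | ε₀ , fl , fr with CentralExt-< j<e (bound ε₀) (Flank-top-inner fl)
      ...   | inj₁ y₀≡j         = Flank-top-outer fl , inj₁ (trans fr (trans (cong σ y₀≡j) (σ-< (m<n⇒m<1+n j<e))))
      ...   | inj₂ (_ , y₀≡D)   = Flank-top-outer fl , inj₂ (trans fr (trans (cong σ y₀≡D) σ-D))
      reversed : reverse ((D ∷ []) ++ central (suc j) ++ []) ≡ central (suc j) ++ D ∷ []
      reversed = trans (reverse-padded (central (suc j)) top none)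
                       (cong (_++ D ∷ []) (central-palindrome (suc j)))
  central-step-< {j = j} j<e none top bs ds bound =
    corner-class (suc j) 0 (s≤s j<e) (s≤s z≤n) extensions
      (inj₁ (e ∸ j , suc j , s≤s (≤-trans (m∸n≤m e j) (n≤1+n e)) , f^-T-branch j j<e))
    where
      extensions : ∀ ε → CornerExt (suc j) 0 (left ε) (right ε)
      extensions ε with ds ε
      ... | ε₀ , fl , fr with CentralExt-< j<e (CentralExt-swap (bound ε₀)) (Flank-top-inner fr)
      ...   | inj₁ x₀≡j         = inj₁ (trans fl (trans (cong σ x₀≡j) (σ-< (m<n⇒m<1+n j<e)))) , Flank-top-outer fr
      ...   | inj₂ (_ , x₀≡D)   = inj₂ (trans fl (trans (cong σ x₀≡D) σ-D)) , Flank-top-outer fr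
  central-step-< {j = j} j<e top top bs ds bound = ⊥-elim (not-left-forced bs left-D)
    where
      left-D : ∀ ε → left ε ≡ D
      left-D ε with ds ε
      ... | ε₀ , fl , fr with CentralExt-< j<e (bound ε₀) (Flank-top-inner fl) | Flank-top-inner fr
      ...   | inj₁ y₀≡j       | inj₁ y₀≡e = ⊥-elim (<⇒≢ j<e (trans (sym y₀≡j) y₀≡e))
      ...   | inj₁ y₀≡j       | inj₂ y₀≡D = ⊥-elim (<⇒≢ (m<n⇒m<1+n j<e) (trans (sym y₀≡j) y₀≡D))
      ...   | inj₂ (x₀≡D , _) | _        = Flank-top-D (subst (λ t → Flank (D ∷ []) t (left ε)) x₀≡D fl)

  data CornerStep (P : Word) (a : ℕ) : Set where
    forced : (∀ {x₀ x} → Flank P x₀ x → x₀ ≡ a ⊎ x₀ ≡ D → x ≡ D) → CornerStep P a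
    step   : P ≡ padFor a →
             (∀ {x₀ x} → Flank P x₀ x → x₀ ≡ a ⊎ x₀ ≡ D → x ≡ suc a % D ⊎ x ≡ D) → CornerStep P a

  cornerStep : ∀ {P a} → Pad P → a < D → CornerStep P a
  cornerStep {a = a} none a<D with m≤n⇒m<n∨m≡n (≤-pred a<D)
  ... | inj₁ a<e  = step (cong (λ b → if b then D ∷ [] else []) (sym (≡ᵇ-false (<⇒≢ a<e)))) next
    where
      next : ∀ {x₀ x} → Flank [] x₀ x → x₀ ≡ a ⊎ x₀ ≡ D → x ≡ suc a % D ⊎ x ≡ D
      next fl (inj₁ refl) = inj₁ (trans fl (trans (σ-< a<D) (sym (suc-%-< a<e))))
      next fl (inj₂ refl) = inj₂ (trans fl σ-D)
  ... | inj₂ refl = forced λ fl x₀∈ → trans fl (σ-e-or-D x₀∈)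
  cornerStep {a = a} top a<D with m≤n⇒m<n∨m≡n (≤-pred a<D)
  ... | inj₁ a<e  = forced next
    where
      next : ∀ {x₀ x} → Flank (D ∷ []) x₀ x → x₀ ≡ a ⊎ x₀ ≡ D → x ≡ D
      next (inj₁ (refl , _)) (inj₁ refl) = ⊥-elim (<-irrefl refl a<e)
      next (inj₁ (refl , _)) (inj₂ ())
      next (inj₂ (_ , x≡D))  _           = x≡D
  ... | inj₂ refl = step (cong (λ b → if b then D ∷ [] else []) (sym (≡ᵇ-refl e))) next
    where
      next : ∀ {x₀ x} → Flank (D ∷ []) x₀ x → x₀ ≡ e ⊎ x₀ ≡ D → x ≡ suc e % D ⊎ x ≡ D
      next (inj₁ (_ , x≡0)) _ = inj₁ (trans x≡0 (sym suc-e-%))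
      next (inj₂ (_ , x≡D)) _ = inj₂ x≡D

  corner-step : ∀ {P S v a b} → Pad P → Pad S → a < D → b < D → let w = P ++ (φ d v ++ 0 ∷ []) ++ S in
    Bispecial₂ w → Desubst P S v w → (∀ (ε₀ : Ext v) → CornerExt a b (left ε₀) (right ε₀)) →
    InOrbit (a , v , b) ⊎ InOrbit (b , reverse v , a) → Class w
  corner-step padP padS a<D b<D bs ds bound orbit with cornerStep padP a<D | cornerStep padS b<D
  ... | forced h | _ = ⊥-elim (not-left-forced bs λ ε →
          let (ε₀ , fl , _) = ds ε in h fl (proj₁ (bound ε₀)))
  ... | step _ _ | forced h = ⊥-elim (not-right-forced bs λ ε →
          let (ε₀ , _ , fr) = ds ε in h fr (proj₂ (bound ε₀)))
  corner-step {v = v} {a} {b} padP padS _ _ bs ds bound orbit | step refl hP | step refl hS =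
    corner-class (suc a % D) (suc b % D) (m%n<n (suc a) D) (m%n<n (suc b) D) extensions (next orbit)
    where
      extensions : ∀ ε → CornerExt (suc a % D) (suc b % D) (left ε) (right ε)
      extensions ε = let (ε₀ , fl , fr) = ds ε in hP fl (proj₁ (bound ε₀)) , hS fr (proj₂ (bound ε₀))
      w = padFor a ++ (φ d v ++ 0 ∷ []) ++ padFor b
      reversed : reverse w ≡ padFor b ++ (φ d (reverse v) ++ 0 ∷ []) ++ padFor a
      reversed = trans (reverse-padded _ padP padS) (cong (λ t → padFor b ++ t ++ padFor a) (reverse-image v))
      next : InOrbit (a , v , b) ⊎ InOrbit (b , reverse v , a) →
             InOrbit (suc a % D , w , suc b % D) ⊎ InOrbit (suc b % D , reverse w , suc a % D)
      next (inj₁ o) = inj₁ (InOrbit-f o)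
      next (inj₂ o) = inj₂ (subst (λ t → InOrbit (suc b % D , t , suc a % D)) (sym reversed) (InOrbit-f o))

  class-step : ∀ {P S v} → Pad P → Pad S → let w = P ++ (φ d v ++ 0 ∷ []) ++ S in
    Bispecial₂ w → Desubst P S v w → Class v → Class w
  class-step padP padS bs ds (central-class j j≤e refl bound) with m≤n⇒m<n∨m≡n j≤e
  ... | inj₁ j<e  = central-step-< j<e padP padS bs ds bound
  ... | inj₂ refl = central-step-e padP padS bs ds bound
  class-step padP padS bs ds (corner-class a b a<D b<D bound orbit) =
    corner-step padP padS a<D b<D bs ds bound orbit

  classify : ∀ w → Acc _<_ (length w) → Bispecial₂ w → Class w
  classify w (acc smaller) bs with shape w bs
  ... | empty  = central-class 0 z≤n refl λ ε → Adjacent⇒CentralExt-0 (Local-adjacent (ext-local ε))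
  ... | single = corner-class 0 0 (s≤s z≤n) (s≤s z≤n)
      (λ ε → let l = ext-local ε in
             Adjacent-D-right (Local-adjacent l) , Adjacent-D-left (Local-adjacent (Local-tail _ _ l)))
      (inj₁ (D , 0 , ≤-refl , T-D))
  ... | padded {P} {S} z padP padS ends with desubstitution padP padS ends (l₁ bs)
  ...   | v , refl , ds =
    class-step padP padS bs ds (classify v (smaller (shorter P S v)) (Bispecial₂-desubst padP padS ds bs))

  bispecial-in-orbit : ∀ w → Bispecial d w → ∃ λ k → ∃ λ n → k < d ×
    (assoc (f^ d n (T d k)) ≡ w ⊎ assoc (f^ d n (T d k)) ≡ reverse w)
  bispecial-in-orbit w bw with classify w (<-wellFounded (length w)) (Bispecial⇒Bispecial₂ w bw)
  ... | central-class j j≤e refl _ =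
    0 , j , s≤s z≤n , inj₁ (cong assoc (f^-T-central 0 j (≤-trans (≤-reflexive (+-identityʳ j)) j≤e)))
  ... | corner-class _ _ _ _ _ (inj₁ (k , n , k<d , eq)) = k , n , k<d , inj₁ (cong assoc eq)
  ... | corner-class _ _ _ _ _ (inj₂ (k , n , k<d , eq)) = k , n , k<d , inj₂ (cong assoc eq)

corollary11 : (d : ℕ) → 3 ≤ d → ∀ w → Bispecial d w →
    Σ ℕ λ k → Σ ℕ λ n → k < d ×
      (assoc (f^ d n (T d k)) ≡ w ⊎ assoc (f^ d n (T d k)) ≡ reverse w)
corollary11 zero                ()
corollary11 (suc zero)          (s≤s ())
corollary11 (suc (suc zero))    (s≤s (s≤s ()))
corollary11 (suc (suc (suc m))) _ = bispecial-in-orbit m
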